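{- Let $k$ be a positive integer, $m=4k+1$, and let $M$ be a maximum induced matching of the grid $G_{3,m}$. Then at least $2k$ vertices of the row $U_1=\{u_1v_1,u_1v_2,\dots,u_1v_m\}$ are saturated by $M$.
   Context: For integers $n,m\geq 2$, the grid $G_{n,m}$ is the Cartesian product of the path $P_n=u_1u_2\cdots u_n$ and the path $P_m=v_1v_2\cdots v_m$; its vertices are written $u_iv_j$ ($1\le i\le n$, $1\le j\le m$), and $u_iv_j$, $u_kv_l$ are adjacent iff either $i=k$ and $|j-l|=1$, or $j=l$ and $|i-k|=1$. An induced matching of a graph $G$ is a set $M$ of pairwise vertex-disjoint edges such that no edge of $G$ joins endpoints of two distinct edges of $M$; a maximum induced matching is one of largest possible size. A vertex is saturated by $M$ if it is an endpoint of an edge of $M$. -}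

module Defs where

open import Data.Nat using (ℕ; suc; _+_; _≤_)
open import Data.Fin using (Fin; toℕ)
open import Data.Product using (_×_; _,_; proj₁; proj₂)
open import Data.Sum using (_⊎_)
open import Data.List using (List; length; lookup)
open import Data.List.Relation.Unary.Any using (Any)
open import Relation.Binary.PropositionalEquality using (_≡_; _≢_)
open import Relation.Nullary using (¬_)

-- Vertex u_i v_j of the grid G_{n,m} is the pair (i , j) : Fin n × Fin m
-- (0-based indices: Fin index i corresponds to u_{i+1}).
Vertex : ℕ → ℕ → Set
Vertex n m = Fin n × Fin m

Adjacentℕ : ℕ → ℕ → Set
Adjacentℕ a b = (suc a ≡ b) ⊎ (suc b ≡ a)

Adj : {n m : ℕ} → Vertex n m → Vertex n m → Set
Adj (i , j) (k , l) =
  (i ≡ k × Adjacentℕ (toℕ j) (toℕ l)) ⊎ (j ≡ l × Adjacentℕ (toℕ i) (toℕ k))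

Edge : ℕ → ℕ → Set
Edge n m = Vertex n m × Vertex n m

IsEdge : {n m : ℕ} → Edge n m → Set
IsEdge (a , b) = Adj a b

Separated : {n m : ℕ} → Edge n m → Edge n m → Set
Separated (a , b) (c , d) =
  (a ≢ c × a ≢ d × b ≢ c × b ≢ d) ×
  (¬ Adj a c × ¬ Adj a d × ¬ Adj b c × ¬ Adj b d)

-- an induced matching of G_{n,m}, given as a list of edges
-- (distinct list positions are distinct edges, as they must be separated)
IsInducedMatching : (n m : ℕ) → List (Edge n m) → Set
IsInducedMatching n m M =
  ((p : Fin (length M)) → IsEdge (lookup M p)) ×
  ((p q : Fin (length M)) → p ≢ q → Separated (lookup M p) (lookup M q))

IsMaximumInducedMatching : (n m : ℕ) → List (Edge n m) → Set
IsMaximumInducedMatching n m M =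
  IsInducedMatching n m M ×
  ((M' : List (Edge n m)) → IsInducedMatching n m M' → length M' ≤ length M)

Saturated : {n m : ℕ} → Vertex n m → List (Edge n m) → Set
Saturated x M = Any (λ e → (x ≡ proj₁ e) ⊎ (x ≡ proj₂ e)) M

module Submission where

-- The 2|M| endpoints of an induced matching M are distinct, so counting the
-- saturated vertices column by column gives 2|M|. In two consecutive columns the vertices of
-- rows u₂, u₃ form a 4-cycle, and any three of them contain a path x–y–z, which an induced
-- matching cannot saturate entirely; so each such pair of columns holds at most two saturated
-- vertices, and rows u₂, u₃ contribute at most m + 1 in total. Hence 2|M| ≤ s + m + 1, where s
-- is the number of saturated vertices of U₁. On the other hand, repeating the block
-- u₁v₁u₁v₂, u₃v₁u₃v₂, u₂v₃u₂v₄ every four columns and closing off with four edges on the last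
-- five columns gives an induced matching with 3k + 1 edges in G₃,₄ₖ₊₁; so for a maximum M,
-- 6k + 2 ≤ 2|M| ≤ s + 4k + 2.

open import Defs
open import Data.Nat using (ℕ; _+_; _*_; _≤_)
open import Data.Fin using (Fin; zero)
open import Data.Fin.Subset using (Subset; _∈_; ∣_∣)
open import Data.Product using (Σ; _×_; _,_)
open import Data.List using (List)

open import Data.Bool using (true; false; if_then_else_)
open import Data.Empty using (⊥; ⊥-elim)
open import Data.Fin using (suc; toℕ; _↑ʳ_)
open import Data.Fin.Patterns using (0F; 1F; 2F; 3F; 4F)
import Data.Fin.Properties as Fin
open import Data.Fin.Properties using (toℕ-↑ʳ; ↑ʳ-injective)
open import Data.List using ([]; _∷_; _++_; map; length; lookup)
open import Data.List.Properties using (tabulate-lookup; length-map)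
open import Data.List.Membership.Propositional using () renaming (_∈_ to _∈ₗ_; _∉_ to _∉ₗ_)
open import Data.List.Membership.Propositional.Properties using (∈-lookup)
import Data.List.Membership.DecPropositional as DecMembership
open import Data.List.Relation.Unary.Any using (here; there)
open import Data.List.Relation.Unary.All as All using (All; []; _∷_)
import Data.List.Relation.Unary.All.Properties as All
open import Data.List.Relation.Unary.AllPairs as AllPairs using (AllPairs; []; _∷_)
import Data.List.Relation.Unary.AllPairs.Properties as AllPairs
open import Data.List.Relation.Unary.Unique.Propositional using (Unique)
open import Data.Nat using (zero; suc; _<_; z≤n; s≤s; z<s)
import Data.Nat as ℕ
open import Data.Nat.Properties
  using ( +-*-semiring; +-identityʳ; +-assoc; +-suc; *-identityˡ; *-suc; 1+n≢n; 1+n≰n; n≤1+n; m≤m+n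
        ; ≤-refl; ≤-reflexive; ≤-trans; +-mono-≤; +-monoˡ-≤; +-monoʳ-≤; *-monoʳ-≤
        ; +-cancelˡ-≡; +-cancelʳ-≤; module ≤-Reasoning)
open import Data.Nat.Tactic.RingSolver using (solve-∀)
open import Algebra.Properties.Semiring.Sum +-*-semiring
  using (sum-syntax; ∑-distrib-+; *-distribʳ-sum; sum-cong-≗; sum-replicate-zero)
open import Data.Product using (proj₁; proj₂)
open import Data.Product.Properties using (≡-dec)
open import Data.Sum using (_⊎_; inj₁; inj₂)
open import Data.Vec using () renaming (tabulate to tabulateᵥ)
open import Data.Vec.Properties using (lookup∘tabulate; []=⇒lookup)
open import Function using (_∘_)
open import Function.Bundles using (_⇔_; mk⇔; Equivalence)
open import Relation.Binary.Core using (Rel)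
open import Relation.Binary.Definitions using (DecidableEquality; Symmetric)
open import Relation.Binary.PropositionalEquality
open import Relation.Nullary using (¬_; Dec; yes; no; does; contradiction)
open import Relation.Nullary.Decidable using (_×-dec_; _⊎-dec_; ¬?; from-yes)
open import Relation.Unary using (Pred) renaming (Decidable to Decidable₁)

𝟙 : ∀ {p} {P : Set p} → Dec P → ℕ
𝟙 d = if does d then 1 else 0

∑-mono-≤ : ∀ {n} {f g : Fin n → ℕ} → (∀ i → f i ≤ g i) → ∑[ i < n ] f i ≤ ∑[ i < n ] g i
∑-mono-≤ {zero} _ = z≤n
∑-mono-≤ {suc n} f≤g = +-mono-≤ (f≤g zero) (∑-mono-≤ (f≤g ∘ suc))

∑-𝟙-≟ : ∀ {n} (r : Fin n) → ∑[ i < n ] 𝟙 (i Fin.≟ r) ≡ 1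
∑-𝟙-≟ {suc n} zero = cong suc (sum-replicate-zero n)
∑-𝟙-≟ {suc n} (suc r) = ∑-𝟙-≟ r

∑≤1+n : ∀ {n} (t : Fin n → ℕ) → (∀ j → t j ≤ 2) →
  (∀ j j′ → suc (toℕ j) ≡ toℕ j′ → t j + t j′ ≤ 2) → ∑[ j < n ] t j ≤ suc n
∑≤1+n {zero} _ _ _ = z≤n
∑≤1+n {suc zero} t t≤2 _ = ≤-trans (≤-reflexive (+-identityʳ (t 0F))) (t≤2 0F)
∑≤1+n {suc (suc n)} t t≤2 pair≤2 = begin
  t 0F + (t 1F + ∑[ j < n ] t (suc (suc j)))   ≡⟨ sym (+-assoc (t 0F) (t 1F) _) ⟩
  (t 0F + t 1F) + ∑[ j < n ] t (suc (suc j))   ≤⟨ +-mono-≤ (pair≤2 0F 1F refl) rest≤ ⟩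
  2 + suc n                                    ∎
  where
  open ≤-Reasoning
  rest≤ : ∑[ j < n ] t (suc (suc j)) ≤ suc n
  rest≤ = ∑≤1+n (λ j → t (suc (suc j))) (λ j → t≤2 (suc (suc j)))
            (λ j j′ j~j′ → pair≤2 (suc (suc j)) (suc (suc j′)) (cong (2 +_) j~j′))

bits-sum≤1 : ∀ {a b} → a ≤ 1 → b ≤ 1 → (0 < a → 0 < b → ⊥) → a + b ≤ 1
bits-sum≤1 z≤n b≤1 _ = b≤1
bits-sum≤1 (s≤s z≤n) z≤n _ = ≤-refl
bits-sum≤1 (s≤s z≤n) (s≤s z≤n) ab = ⊥-elim (ab z<s z<s)

bits-sum≤2 : ∀ {a b c d} → a ≤ 1 → b ≤ 1 → c ≤ 1 → d ≤ 1 →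
  (0 < a → 0 < b → 0 < c → ⊥) → (0 < a → 0 < b → 0 < d → ⊥) →
  (0 < a → 0 < c → 0 < d → ⊥) → (0 < b → 0 < c → 0 < d → ⊥) →
  (a + b) + (c + d) ≤ 2
bits-sum≤2 z≤n z≤n c≤1 d≤1 _ _ _ _ = +-mono-≤ c≤1 d≤1
bits-sum≤2 z≤n (s≤s z≤n) c≤1 d≤1 _ _ _ bcd = s≤s (bits-sum≤1 c≤1 d≤1 (bcd z<s))
bits-sum≤2 (s≤s z≤n) z≤n c≤1 d≤1 _ _ acd _ = s≤s (bits-sum≤1 c≤1 d≤1 (acd z<s))
bits-sum≤2 (s≤s z≤n) (s≤s z≤n) z≤n z≤n _ _ _ _ = ≤-refl
bits-sum≤2 (s≤s z≤n) (s≤s z≤n) (s≤s z≤n) _ abc _ _ _ = ⊥-elim (abc z<s z<s z<s)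
bits-sum≤2 (s≤s z≤n) (s≤s z≤n) z≤n (s≤s z≤n) _ abd _ _ = ⊥-elim (abd z<s z<s z<s)

∣tabulate-does∣ : ∀ {m p} {P : Pred (Fin m) p} (P? : Decidable₁ P) →
  ∣ tabulateᵥ (does ∘ P?) ∣ ≡ ∑[ j < m ] 𝟙 (P? j)
∣tabulate-does∣ {zero} P? = refl
∣tabulate-does∣ {suc m} P? with does (P? zero)
... | true = cong suc (∣tabulate-does∣ (P? ∘ suc))
... | false = ∣tabulate-does∣ (P? ∘ suc)

∈-tabulate-does : ∀ {m p} {P : Pred (Fin m) p} (P? : Decidable₁ P) {j} → j ∈ tabulateᵥ (does ∘ P?) → P j
∈-tabulate-does P? {j} j∈ with P? j | trans (sym (lookup∘tabulate (does ∘ P?) j)) ([]=⇒lookup j∈)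
... | yes Pj | _ = Pj
... | no _ | ()

allPairs-lookup : ∀ {a ℓ} {A : Set a} {R : Rel A ℓ} → Symmetric R →
  ∀ {xs} → AllPairs R xs → ∀ {p q} → p ≢ q → R (lookup xs p) (lookup xs q)
allPairs-lookup R-sym (_ ∷ _) {zero} {zero} p≢q = contradiction refl p≢q
allPairs-lookup R-sym (Rx ∷ _) {zero} {suc q} _ = All.lookup Rx (∈-lookup q)
allPairs-lookup R-sym (Rx ∷ _) {suc p} {zero} _ = R-sym (All.lookup Rx (∈-lookup p))
allPairs-lookup R-sym (_ ∷ Rxs) {suc p} {suc q} p≢q = allPairs-lookup R-sym Rxs (p≢q ∘ cong suc)

module _ {a} {A : Set a} (_≟_ : DecidableEquality A) where

  open DecMembership _≟_ using (_∈?_)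

  multiplicity : A → List A → ℕ
  multiplicity x [] = 0
  multiplicity x (y ∷ ys) = 𝟙 (x ≟ y) + multiplicity x ys

  multiplicity-∉ : ∀ {x ys} → x ∉ₗ ys → multiplicity x ys ≡ 0
  multiplicity-∉ {x} {[]} _ = refl
  multiplicity-∉ {x} {y ∷ ys} x∉ with x ≟ y
  ... | yes x≡y = contradiction (here x≡y) x∉
  ... | no _ = multiplicity-∉ (x∉ ∘ there)

  multiplicity>0⇒∈ : ∀ {x ys} → 0 < multiplicity x ys → x ∈ₗ ys
  multiplicity>0⇒∈ {x} {y ∷ ys} pos with x ≟ y
  ... | yes x≡y = here x≡y
  ... | no _ = there (multiplicity>0⇒∈ pos)

  multiplicity-unique : ∀ {x ys} → Unique ys → multiplicity x ys ≤ 1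
  multiplicity-unique {x} {[]} _ = z≤n
  multiplicity-unique {x} {y ∷ ys} (y∉ys ∷ ys!) with x ≟ y
  ... | yes refl = s≤s (≤-reflexive (multiplicity-∉ (All.All¬⇒¬Any y∉ys)))
  ... | no _ = multiplicity-unique ys!

  multiplicity≤𝟙-∈ : ∀ {x ys} → Unique ys → multiplicity x ys ≤ 𝟙 (x ∈? ys)
  multiplicity≤𝟙-∈ {x} {ys} ys! with x ∈? ys
  ... | yes _ = multiplicity-unique ys!
  ... | no x∉ys = ≤-reflexive (multiplicity-∉ x∉ys)

adjacentℕ? : ∀ a b → Dec (Adjacentℕ a b)
adjacentℕ? a b = (suc a ℕ.≟ b) ⊎-dec (suc b ℕ.≟ a)

adjacentℕ-sym : ∀ {a b} → Adjacentℕ a b → Adjacentℕ b a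
adjacentℕ-sym (inj₁ e) = inj₂ e
adjacentℕ-sym (inj₂ e) = inj₁ e

adjacentℕ-irrefl : ∀ {a} → ¬ Adjacentℕ a a
adjacentℕ-irrefl (inj₁ e) = 1+n≢n e
adjacentℕ-irrefl (inj₂ e) = 1+n≢n e

adjacentℕ⇒≤1+ : ∀ {a b} → Adjacentℕ a b → b ≤ suc a
adjacentℕ⇒≤1+ (inj₁ refl) = ≤-refl
adjacentℕ⇒≤1+ {b = b} (inj₂ refl) = ≤-trans (n≤1+n b) (n≤1+n (suc b))

+-adjacentℕ : ∀ d {a b} → Adjacentℕ a b → Adjacentℕ (d + a) (d + b)
+-adjacentℕ d {a} (inj₁ e) = inj₁ (trans (sym (+-suc d a)) (cong (d +_) e))
+-adjacentℕ d {b = b} (inj₂ e) = inj₂ (trans (sym (+-suc d b)) (cong (d +_) e))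

+-adjacentℕ⁻ : ∀ d {a b} → Adjacentℕ (d + a) (d + b) → Adjacentℕ a b
+-adjacentℕ⁻ d {a} {b} (inj₁ e) = inj₁ (+-cancelˡ-≡ d (suc a) b (trans (+-suc d a) e))
+-adjacentℕ⁻ d {a} {b} (inj₂ e) = inj₂ (+-cancelˡ-≡ d (suc b) a (trans (+-suc d b) e))

_≟ᵥ_ : ∀ {n m} → DecidableEquality (Vertex n m)
_≟ᵥ_ = ≡-dec Fin._≟_ Fin._≟_

𝟙-≟ᵥ : ∀ {n m} (i r : Fin n) (j c : Fin m) → 𝟙 ((i , j) ≟ᵥ (r , c)) ≡ 𝟙 (i Fin.≟ r) * 𝟙 (j Fin.≟ c)
𝟙-≟ᵥ i r j c with i Fin.≟ r
... | yes refl = sym (*-identityˡ _)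
... | no _ = refl

∑∑-𝟙-≟ᵥ : ∀ {n m} (x : Vertex n m) → ∑[ j < m ] ∑[ i < n ] 𝟙 ((i , j) ≟ᵥ x) ≡ 1
∑∑-𝟙-≟ᵥ {n} {m} (r , c) = begin
  ∑[ j < m ] ∑[ i < n ] 𝟙 ((i , j) ≟ᵥ (r , c))
    ≡⟨ sum-cong-≗ (λ j → sum-cong-≗ (λ i → 𝟙-≟ᵥ i r j c)) ⟩
  ∑[ j < m ] ∑[ i < n ] (𝟙 (i Fin.≟ r) * 𝟙 (j Fin.≟ c))
    ≡⟨ sum-cong-≗ (λ j → sym (*-distribʳ-sum (𝟙 (j Fin.≟ c)) (λ i → 𝟙 (i Fin.≟ r)))) ⟩
  ∑[ j < m ] ((∑[ i < n ] 𝟙 (i Fin.≟ r)) * 𝟙 (j Fin.≟ c))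
    ≡⟨ sum-cong-≗ (λ j → trans (cong (_* 𝟙 (j Fin.≟ c)) (∑-𝟙-≟ r)) (*-identityˡ _)) ⟩
  ∑[ j < m ] 𝟙 (j Fin.≟ c)
    ≡⟨ ∑-𝟙-≟ c ⟩
  1 ∎
  where open ≡-Reasoning

∑∑-multiplicity : ∀ {n m} (xs : List (Vertex n m)) →
  ∑[ j < m ] ∑[ i < n ] multiplicity _≟ᵥ_ (i , j) xs ≡ length xs
∑∑-multiplicity {n} {m} [] =
  trans (cong (λ s → ∑[ j < m ] s) (sum-replicate-zero n)) (sum-replicate-zero m)
∑∑-multiplicity {n} {m} (x ∷ xs) = begin
  ∑[ j < m ] ∑[ i < n ] (δ i j + μ i j)
    ≡⟨ sum-cong-≗ (λ j → ∑-distrib-+ (λ i → δ i j) (λ i → μ i j)) ⟩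
  ∑[ j < m ] (∑[ i < n ] δ i j + ∑[ i < n ] μ i j)
    ≡⟨ ∑-distrib-+ (λ j → ∑[ i < n ] δ i j) (λ j → ∑[ i < n ] μ i j) ⟩
  ∑[ j < m ] ∑[ i < n ] δ i j + ∑[ j < m ] ∑[ i < n ] μ i j
    ≡⟨ cong₂ _+_ (∑∑-𝟙-≟ᵥ x) (∑∑-multiplicity xs) ⟩
  suc (length xs) ∎
  where
  open ≡-Reasoning
  δ μ : Fin n → Fin m → ℕ
  δ i j = 𝟙 ((i , j) ≟ᵥ x)
  μ i j = multiplicity _≟ᵥ_ (i , j) xs

module _ {n m : ℕ} where

  adj? : (x y : Vertex n m) → Dec (Adj x y)
  adj? (i , j) (k , l) =
    ((i Fin.≟ k) ×-dec adjacentℕ? (toℕ j) (toℕ l)) ⊎-dec ((j Fin.≟ l) ×-dec adjacentℕ? (toℕ i) (toℕ k))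

  adj-sym : {x y : Vertex n m} → Adj x y → Adj y x
  adj-sym (inj₁ (i≡k , j~l)) = inj₁ (sym i≡k , adjacentℕ-sym j~l)
  adj-sym (inj₂ (j≡l , i~k)) = inj₂ (sym j≡l , adjacentℕ-sym i~k)

  adj⇒≢ : {x y : Vertex n m} → Adj x y → x ≢ y
  adj⇒≢ (inj₁ (_ , j~j)) refl = adjacentℕ-irrefl j~j
  adj⇒≢ (inj₂ (_ , i~i)) refl = adjacentℕ-irrefl i~i

  Apart : Vertex n m → Vertex n m → Set
  Apart x y = x ≢ y × ¬ Adj x y

  apart-sym : {x y : Vertex n m} → Apart x y → Apart y x
  apart-sym (x≢y , ¬xy) = (x≢y ∘ sym) , (¬xy ∘ adj-sym)

  far-columns-apart : ∀ {i k : Fin n} {j l : Fin m} → 2 + toℕ j ≤ toℕ l → Apart (i , j) (k , l)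
  far-columns-apart {j = j} {l} far =
    (λ { refl → close (n≤1+n (toℕ j)) }) ,
    (λ { (inj₁ (_ , j~l)) → close (adjacentℕ⇒≤1+ j~l) ; (inj₂ (refl , _)) → close (n≤1+n (toℕ j)) })
    where
    close : toℕ l ≤ suc (toℕ j) → ⊥
    close l≤ = 1+n≰n (≤-trans far l≤)

  other-row-and-column-apart : ∀ {i k : Fin n} {j l : Fin m} → i ≢ k → j ≢ l → Apart (i , j) (k , l)
  other-row-and-column-apart i≢k j≢l =
    (λ e → i≢k (cong proj₁ e)) , (λ { (inj₁ (i≡k , _)) → i≢k i≡k ; (inj₂ (j≡l , _)) → j≢l j≡l })

module _ {n m : ℕ} where

  IsEndpoint : Vertex n m → Edge n m → Set
  IsEndpoint v e = v ≡ proj₁ e ⊎ v ≡ proj₂ e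

  Avoids : Vertex n m → Edge n m → Set
  Avoids v e = ¬ IsEndpoint v e

  avoids? : (v : Vertex n m) (e : Edge n m) → Dec (Avoids v e)
  avoids? v e = ¬? ((v ≟ᵥ proj₁ e) ⊎-dec (v ≟ᵥ proj₂ e))

  isEdge? : (e : Edge n m) → Dec (IsEdge e)
  isEdge? (a , b) = adj? a b

  separated? : (e f : Edge n m) → Dec (Separated e f)
  separated? (a , b) (c , d) =
    (¬? (a ≟ᵥ c) ×-dec ¬? (a ≟ᵥ d) ×-dec ¬? (b ≟ᵥ c) ×-dec ¬? (b ≟ᵥ d)) ×-dec
    (¬? (adj? a c) ×-dec ¬? (adj? a d) ×-dec ¬? (adj? b c) ×-dec ¬? (adj? b d))

  apart⇒separated : {a b c d : Vertex n m} →
    Apart a c → Apart a d → Apart b c → Apart b d → Separated (a , b) (c , d)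
  apart⇒separated (a≢c , ¬ac) (a≢d , ¬ad) (b≢c , ¬bc) (b≢d , ¬bd) =
    (a≢c , a≢d , b≢c , b≢d) , (¬ac , ¬ad , ¬bc , ¬bd)

  separated⇒apart : ∀ {a b c d : Vertex n m} {v w} →
    Separated (a , b) (c , d) → IsEndpoint v (a , b) → IsEndpoint w (c , d) → Apart v w
  separated⇒apart ((a≢c , _ , _ , _) , (¬ac , _ , _ , _)) (inj₁ refl) (inj₁ refl) = a≢c , ¬ac
  separated⇒apart ((_ , a≢d , _ , _) , (_ , ¬ad , _ , _)) (inj₁ refl) (inj₂ refl) = a≢d , ¬ad
  separated⇒apart ((_ , _ , b≢c , _) , (_ , _ , ¬bc , _)) (inj₂ refl) (inj₁ refl) = b≢c , ¬bc
  separated⇒apart ((_ , _ , _ , b≢d) , (_ , _ , _ , ¬bd)) (inj₂ refl) (inj₂ refl) = b≢d , ¬bd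

  separated-sym : Symmetric (Separated {n} {m})
  separated-sym {_ , _} {_ , _} s =
    apart⇒separated (apart-sym (separated⇒apart s (inj₁ refl) (inj₁ refl)))
                    (apart-sym (separated⇒apart s (inj₂ refl) (inj₁ refl)))
                    (apart-sym (separated⇒apart s (inj₁ refl) (inj₂ refl)))
                    (apart-sym (separated⇒apart s (inj₂ refl) (inj₂ refl)))

  IsInducedMatching′ : List (Edge n m) → Set
  IsInducedMatching′ M = All IsEdge M × AllPairs Separated M

  isInducedMatching⇔ : ∀ {M} → IsInducedMatching n m M ⇔ IsInducedMatching′ M
  isInducedMatching⇔ {M} = mk⇔
    (λ (edges , separated) → subst IsInducedMatching′ (tabulate-lookup M)
       (All.tabulate⁺ edges , AllPairs.tabulate⁺ (separated _ _)))
    (λ (edges , separated) →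
       (λ p → All.lookup edges (∈-lookup p)) , (λ p q → allPairs-lookup separated-sym separated))

  endpoints : List (Edge n m) → List (Vertex n m)
  endpoints [] = []
  endpoints (e ∷ M) = proj₁ e ∷ proj₂ e ∷ endpoints M

  length-endpoints : ∀ M → length (endpoints M) ≡ 2 * length M
  length-endpoints [] = refl
  length-endpoints (_ ∷ M) = trans (cong (2 +_) (length-endpoints M)) (sym (*-suc 2 (length M)))

  ∈-endpoints⇒saturated : ∀ {v M} → v ∈ₗ endpoints M → Saturated v M
  ∈-endpoints⇒saturated {M = _ ∷ _} (here v≡a) = here (inj₁ v≡a)
  ∈-endpoints⇒saturated {M = _ ∷ _} (there (here v≡b)) = here (inj₂ v≡b)
  ∈-endpoints⇒saturated {M = _ ∷ _} (there (there v∈M)) = there (∈-endpoints⇒saturated v∈M)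

  apart-from-saturated : ∀ {e M v w} → All (Separated e) M → IsEndpoint v e → Saturated w M → Apart v w
  apart-from-saturated {_ , _} (e-f ∷ _) v∈e (here w∈f) = separated⇒apart e-f v∈e w∈f
  apart-from-saturated (_ ∷ e-M) v∈e (there w∈M) = apart-from-saturated e-M v∈e w∈M

  unique-endpoints : ∀ {M} → IsInducedMatching′ M → Unique (endpoints M)
  unique-endpoints {[]} _ = []
  unique-endpoints {e ∷ M} (ab ∷ edges , e-M ∷ separated) =
    (adj⇒≢ ab ∷ distinct (inj₁ refl)) ∷ distinct (inj₂ refl) ∷ unique-endpoints (edges , separated)
    where
    distinct : ∀ {v} → IsEndpoint v e → All (v ≢_) (endpoints M)
    distinct v∈e = All.tabulate λ w∈M → proj₁ (apart-from-saturated e-M v∈e (∈-endpoints⇒saturated w∈M))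

  no-three-distinct-endpoints : ∀ {e x y z} → IsEndpoint x e → IsEndpoint y e → IsEndpoint z e →
    x ≢ y → x ≢ z → y ≢ z → ⊥
  no-three-distinct-endpoints (inj₁ refl) (inj₁ refl) _ x≢y _ _ = x≢y refl
  no-three-distinct-endpoints (inj₂ refl) (inj₂ refl) _ x≢y _ _ = x≢y refl
  no-three-distinct-endpoints (inj₁ refl) (inj₂ refl) (inj₁ refl) _ x≢z _ = x≢z refl
  no-three-distinct-endpoints (inj₁ refl) (inj₂ refl) (inj₂ refl) _ _ y≢z = y≢z refl
  no-three-distinct-endpoints (inj₂ refl) (inj₁ refl) (inj₂ refl) _ x≢z _ = x≢z refl
  no-three-distinct-endpoints (inj₂ refl) (inj₁ refl) (inj₁ refl) _ _ y≢z = y≢z refl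

  no-saturated-path : ∀ {M x y z} → AllPairs Separated M → Adj x y → Adj x z → y ≢ z →
    Saturated x M → Saturated y M → Saturated z M → ⊥
  no-saturated-path _ xy xz y≢z (here x∈e) (here y∈e) (here z∈e) =
    no-three-distinct-endpoints x∈e y∈e z∈e (adj⇒≢ xy) (adj⇒≢ xz) y≢z
  no-saturated-path (e-M ∷ _) xy _ _ (here x∈e) (there y∈M) _ =
    proj₂ (apart-from-saturated e-M x∈e y∈M) xy
  no-saturated-path (e-M ∷ _) _ xz _ (here x∈e) (here _) (there z∈M) =
    proj₂ (apart-from-saturated e-M x∈e z∈M) xz
  no-saturated-path (e-M ∷ _) xy _ _ (there x∈M) (here y∈e) _ =
    proj₂ (apart-from-saturated e-M y∈e x∈M) (adj-sym xy)
  no-saturated-path (e-M ∷ _) _ xz _ (there x∈M) (there _) (here z∈e) =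
    proj₂ (apart-from-saturated e-M z∈e x∈M) (adj-sym xz)
  no-saturated-path (_ ∷ separated) xy xz y≢z (there x∈M) (there y∈M) (there z∈M) =
    no-saturated-path separated xy xz y≢z x∈M y∈M z∈M

  degree : List (Edge n m) → Vertex n m → ℕ
  degree M v = multiplicity _≟ᵥ_ v (endpoints M)

  degree≤1 : ∀ {M v} → IsInducedMatching′ M → degree M v ≤ 1
  degree≤1 im = multiplicity-unique _≟ᵥ_ (unique-endpoints im)

  degree>0⇒saturated : ∀ {M v} → 0 < degree M v → Saturated v M
  degree>0⇒saturated pos = ∈-endpoints⇒saturated (multiplicity>0⇒∈ _≟ᵥ_ pos)

  ∑∑-degree : ∀ M → ∑[ j < m ] ∑[ i < n ] degree M (i , j) ≡ 2 * length M
  ∑∑-degree M = trans (∑∑-multiplicity (endpoints M)) (length-endpoints M)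

-- The upper bound: double counting in G₃,ₘ

module _ {n m : ℕ} (M : List (Edge (suc n) m)) where

  topSaturated? : Decidable₁ (λ j → (0F , j) ∈ₗ endpoints M)
  topSaturated? j = (0F , j) ∈? endpoints M
    where open DecMembership _≟ᵥ_ using (_∈?_)

  topRowSaturated : Subset m
  topRowSaturated = tabulateᵥ (does ∘ topSaturated?)

  ∈-topRowSaturated : ∀ {j} → j ∈ topRowSaturated → Saturated (0F , j) M
  ∈-topRowSaturated j∈ = ∈-endpoints⇒saturated (∈-tabulate-does topSaturated? j∈)

module _ {m : ℕ} {M : List (Edge 3 m)} (im : IsInducedMatching′ M) where

  lowerDegree : Fin m → ℕ
  lowerDegree j = degree M (1F , j) + degree M (2F , j)

  -- a = (1F , j), b = (2F , j), c = (1F , j′), d = (2F , j′) form the 4-cycle a–b–d–c–a, so any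
  -- three of them form a path centred at the one adjacent to the other two.
  lowerDegree-consecutive≤2 : ∀ j j′ → suc (toℕ j) ≡ toℕ j′ → lowerDegree j + lowerDegree j′ ≤ 2
  lowerDegree-consecutive≤2 j j′ j~j′ = bits-sum≤2 (degree≤1 im) (degree≤1 im) (degree≤1 im) (degree≤1 im)
    (λ a b c → path ab ac (λ ()) a b c)
    (λ a b d → path (adj-sym ab) bd (λ ()) b a d)
    (λ a c d → path (adj-sym ac) cd (λ ()) c a d)
    (λ b c d → path (adj-sym bd) (adj-sym cd) (λ ()) d b c)
    where
    path : ∀ {x y z} → Adj x y → Adj x z → y ≢ z → 0 < degree M x → 0 < degree M y → 0 < degree M z → ⊥
    path xy xz y≢z x y z =
      no-saturated-path (proj₂ im) xy xz y≢z (degree>0⇒saturated x) (degree>0⇒saturated y) (degree>0⇒saturated z)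
    ab : Adj {3} {m} (1F , j) (2F , j)
    ab = inj₂ (refl , inj₁ refl)
    ac : Adj {3} {m} (1F , j) (1F , j′)
    ac = inj₁ (refl , inj₁ j~j′)
    bd : Adj {3} {m} (2F , j) (2F , j′)
    bd = inj₁ (refl , inj₁ j~j′)
    cd : Adj {3} {m} (1F , j′) (2F , j′)
    cd = inj₂ (refl , inj₁ refl)

  2*length≤∑-topDegree+1+m : 2 * length M ≤ ∑[ j < m ] degree M (0F , j) + suc m
  2*length≤∑-topDegree+1+m = begin
    2 * length M
      ≡⟨ sym (∑∑-degree M) ⟩
    ∑[ j < m ] ∑[ i < 3 ] degree M (i , j)
      ≡⟨ sum-cong-≗ (λ j → cong (λ d → degree M (0F , j) + (degree M (1F , j) + d)) (+-identityʳ _)) ⟩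
    ∑[ j < m ] (degree M (0F , j) + lowerDegree j)
      ≡⟨ ∑-distrib-+ (λ j → degree M (0F , j)) lowerDegree ⟩
    ∑[ j < m ] degree M (0F , j) + ∑[ j < m ] lowerDegree j
      ≤⟨ +-monoʳ-≤ _ (∑≤1+n lowerDegree (λ _ → +-mono-≤ (degree≤1 im) (degree≤1 im)) lowerDegree-consecutive≤2) ⟩
    ∑[ j < m ] degree M (0F , j) + suc m
      ∎
    where open ≤-Reasoning

  ∑-topDegree≤∣topRowSaturated∣ : ∑[ j < m ] degree M (0F , j) ≤ ∣ topRowSaturated M ∣
  ∑-topDegree≤∣topRowSaturated∣ =
    ≤-trans (∑-mono-≤ {g = 𝟙 ∘ topSaturated? M} (λ _ → multiplicity≤𝟙-∈ _≟ᵥ_ (unique-endpoints im)))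
            (≤-reflexive (sym (∣tabulate-does∣ (topSaturated? M))))

-- The lower bound: a staggered induced matching

module _ {n m : ℕ} (d : ℕ) where

  shiftᵥ : Vertex n m → Vertex n (d + m)
  shiftᵥ (i , j) = i , d ↑ʳ j

  shiftₑ : Edge n m → Edge n (d + m)
  shiftₑ e = shiftᵥ (proj₁ e) , shiftᵥ (proj₂ e)

  shiftᵥ-injective : ∀ {x y} → shiftᵥ x ≡ shiftᵥ y → x ≡ y
  shiftᵥ-injective {_ , j} {_ , l} e = cong₂ _,_ (cong proj₁ e) (↑ʳ-injective d j l (cong proj₂ e))

  adj-shift : ∀ {x y} → Adj x y → Adj (shiftᵥ x) (shiftᵥ y)
  adj-shift {_ , j} {_ , l} (inj₁ (i≡k , j~l)) =
    inj₁ (i≡k , subst₂ Adjacentℕ (sym (toℕ-↑ʳ d j)) (sym (toℕ-↑ʳ d l)) (+-adjacentℕ d j~l))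
  adj-shift (inj₂ (j≡l , i~k)) = inj₂ (cong (d ↑ʳ_) j≡l , i~k)

  adj-unshift : ∀ {x y} → Adj (shiftᵥ x) (shiftᵥ y) → Adj x y
  adj-unshift {_ , j} {_ , l} (inj₁ (i≡k , j~l)) =
    inj₁ (i≡k , +-adjacentℕ⁻ d (subst₂ Adjacentℕ (toℕ-↑ʳ d j) (toℕ-↑ʳ d l) j~l))
  adj-unshift {_ , j} {_ , l} (inj₂ (j≡l , i~k)) = inj₂ (↑ʳ-injective d j l j≡l , i~k)

  separated-shift : ∀ {e f} → Separated e f → Separated (shiftₑ e) (shiftₑ f)
  separated-shift {_ , _} {_ , _} ((a≢c , a≢d , b≢c , b≢d) , (¬ac , ¬ad , ¬bc , ¬bd)) =
    (a≢c ∘ shiftᵥ-injective , a≢d ∘ shiftᵥ-injective , b≢c ∘ shiftᵥ-injective , b≢d ∘ shiftᵥ-injective) ,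
    (¬ac ∘ adj-unshift , ¬ad ∘ adj-unshift , ¬bc ∘ adj-unshift , ¬bd ∘ adj-unshift)

  inducedMatching-shift : ∀ {M} → IsInducedMatching′ M → IsInducedMatching′ (map shiftₑ M)
  inducedMatching-shift (edges , separated) =
    All.map⁺ (All.map adj-shift edges) , AllPairs.map⁺ (AllPairs.map separated-shift separated)

shiftₑ-avoids-column₀ : ∀ {n m d} {i : Fin n} (f : Edge n m) → Avoids (i , zero) (shiftₑ (suc d) f)
shiftₑ-avoids-column₀ _ (inj₁ ())
shiftₑ-avoids-column₀ _ (inj₂ ())

-- A block ends with the edge u₂v₃u₂v₄, so it can be glued in front of a matching shifted by four
-- columns provided that matching leaves u₂v₁ free.
module _ {m : ℕ} where

  ApartFromShifted : Vertex 3 (4 + suc m) → Set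
  ApartFromShifted v = ∀ (w : Vertex 3 (suc m)) → w ≢ (1F , 0F) → Apart v (shiftᵥ 4 w)

  apartFromShifted-left : ∀ {i : Fin 3} {j} → toℕ j ≤ 2 → ApartFromShifted (i , j)
  apartFromShifted-left j≤2 (_ , l) _ = far-columns-apart (≤-trans (+-monoʳ-≤ 2 j≤2) (m≤m+n 4 (toℕ l)))

  apartFromShifted-corner : ApartFromShifted (1F , 3F)
  apartFromShifted-corner (_ , zero) w≢ = other-row-and-column-apart (λ 1≡i → w≢ (cong (_, 0F) (sym 1≡i))) (λ ())
  apartFromShifted-corner (_ , suc _) _ = far-columns-apart (s≤s (s≤s (s≤s (s≤s (s≤s z≤n)))))

  separated-from-shifted : ∀ {a b f} → ApartFromShifted a → ApartFromShifted b → Avoids (1F , 0F) f →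
    Separated (a , b) (shiftₑ 4 f)
  separated-from-shifted a⊥ b⊥ avoid = apart⇒separated (a⊥ _ c≢) (a⊥ _ d≢) (b⊥ _ c≢) (b⊥ _ d≢)
    where
    c≢ = λ e → avoid (inj₁ (sym e))
    d≢ = λ e → avoid (inj₂ (sym e))

  block : List (Edge 3 (4 + suc m))
  block = ((0F , 0F) , (0F , 1F)) ∷ ((2F , 0F) , (2F , 1F)) ∷ ((1F , 2F) , (1F , 3F)) ∷ []

  block-separated-from-shifted : ∀ {M} → All (Avoids (1F , 0F)) M →
    All (λ e → All (Separated e) (map (shiftₑ 4) M)) block
  block-separated-from-shifted {M} avoid =
    beside (apartFromShifted-left z≤n) (apartFromShifted-left (s≤s z≤n)) ∷
    beside (apartFromShifted-left z≤n) (apartFromShifted-left (s≤s z≤n)) ∷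
    beside (apartFromShifted-left (s≤s (s≤s z≤n))) apartFromShifted-corner ∷ []
    where
    beside : ∀ {a b} → ApartFromShifted a → ApartFromShifted b → All (Separated (a , b)) (map (shiftₑ 4) M)
    beside a⊥ b⊥ = All.map⁺ (All.map (separated-from-shifted a⊥ b⊥) avoid)

staggered : (k : ℕ) → List (Edge 3 (5 + k * 4))
staggered zero =
  ((0F , 0F) , (0F , 1F)) ∷ ((2F , 0F) , (2F , 1F)) ∷ ((0F , 3F) , (0F , 4F)) ∷ ((2F , 3F) , (2F , 4F)) ∷ []
staggered (suc k) = block ++ map (shiftₑ 4) (staggered k)

length-staggered : ∀ k → length (staggered k) ≡ 4 + k * 3
length-staggered zero = refl
length-staggered (suc k) = cong (3 +_) (trans (length-map (shiftₑ 4) (staggered k)) (length-staggered k))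

staggered-avoids : ∀ k → All (Avoids (1F , 0F)) (staggered k)
staggered-avoids zero = from-yes (All.all? (avoids? (1F , 0F)) (staggered 0))
staggered-avoids (suc k) =
  All.++⁺ (from-yes (All.all? (avoids? (1F , 0F)) block))
          (All.map⁺ (All.universal shiftₑ-avoids-column₀ (staggered k)))

staggered-inducedMatching : ∀ k → IsInducedMatching′ (staggered k)
staggered-inducedMatching zero =
  from-yes (All.all? isEdge? (staggered 0)) , from-yes (AllPairs.allPairs? separated? (staggered 0))
staggered-inducedMatching (suc k) =
  All.++⁺ (from-yes (All.all? isEdge? block)) (proj₁ shifted) ,
  AllPairs.++⁺ (from-yes (AllPairs.allPairs? separated? block)) (proj₂ shifted)
               (block-separated-from-shifted (staggered-avoids k))
  where
  shifted = inducedMatching-shift 4 (staggered-inducedMatching k)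

large-inducedMatching : ∀ k → Σ (List (Edge 3 (4 * suc k + 1))) λ M →
  IsInducedMatching 3 (4 * suc k + 1) M × length M ≡ 3 * suc k + 1
large-inducedMatching k = subst Large (columns k)
  (staggered k , Equivalence.from isInducedMatching⇔ (staggered-inducedMatching k) , trans (length-staggered k) (edges k))
  where
  Large : ℕ → Set
  Large m = Σ (List (Edge 3 m)) λ M → IsInducedMatching 3 m M × length M ≡ 3 * suc k + 1
  columns : ∀ k → 5 + k * 4 ≡ 4 * suc k + 1
  columns = solve-∀
  edges : ∀ k → 4 + k * 3 ≡ 3 * suc k + 1
  edges = solve-∀

3[1+k]+1≤maximum : ∀ k {M} → IsMaximumInducedMatching 3 (4 * suc k + 1) M → 3 * suc k + 1 ≤ length M
3[1+k]+1≤maximum k (_ , maximal) with large-inducedMatching k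
... | M′ , isIM′ , |M′| = ≤-trans (≤-reflexive (sym |M′|)) (maximal M′ isIM′)

2k≤s : ∀ k s L → 3 * k + 1 ≤ L → 2 * L ≤ s + suc (4 * k + 1) → 2 * k ≤ s
2k≤s k s L 3k+1≤L 2L≤ = +-cancelʳ-≤ (4 * k + 2) (2 * k) s (begin
  2 * k + (4 * k + 2)  ≡⟨ lhs k ⟩
  2 * (3 * k + 1)      ≤⟨ *-monoʳ-≤ 2 3k+1≤L ⟩
  2 * L                ≤⟨ 2L≤ ⟩
  s + suc (4 * k + 1)  ≡⟨ rhs k s ⟩
  s + (4 * k + 2)      ∎)
  where
  open ≤-Reasoning
  lhs : ∀ k → 2 * k + (4 * k + 2) ≡ 2 * (3 * k + 1)
  lhs = solve-∀
  rhs : ∀ k s → s + suc (4 * k + 1) ≡ s + (4 * k + 2)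
  rhs = solve-∀

theorem3p7 : (k : ℕ) → 1 ≤ k → (M : List (Edge 3 (4 * k + 1))) →
    IsMaximumInducedMatching 3 (4 * k + 1) M →
    Σ (Subset (4 * k + 1)) (λ S →
      (2 * k ≤ ∣ S ∣) × ((j : Fin (4 * k + 1)) → j ∈ S → Saturated (zero , j) M))
theorem3p7 (suc k) _ M maximum@(isIM , _) =
  topRowSaturated M , 2k≤s (suc k) _ _ (3[1+k]+1≤maximum k {M} maximum) double-counting ,
  λ _ → ∈-topRowSaturated M
  where
  im : IsInducedMatching′ M
  im = Equivalence.to isInducedMatching⇔ isIM
  double-counting : 2 * length M ≤ ∣ topRowSaturated M ∣ + suc (4 * suc k + 1)
  double-counting = ≤-trans (2*length≤∑-topDegree+1+m im) (+-monoˡ-≤ _ (∑-topDegree≤∣topRowSaturated∣ im))
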